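{- Fix $k\ge2$ and write $A_xy=A_x(k,y)$. Let $a,b,c,m,w$ be natural numbers such that $A_ab+c=w<\min\{A_a(b+1),\,A_0A_ab\}$. Then $w\equiv_k A_ab+c$ if either (1) $m\equiv_k A_a(b+1)$ and $A_a(b+1)>A_am_{ -1}$, where $m_{ -1}$ is the penultimate sandwiching value of $m$; or (2) $m\equiv_k A_ab+c'$ for some natural number $c'$.
   Context: Ackermann function: for $k\ge 2$, $a,b\ge 0$: $A_a(k,-1):=1$, $A_0(k,b):=k^b$, $A_{a+1}(k,b):=A_a(k,\cdot)^k(A_{a+1}(k,b-1))$, with $f^j$ the $j$-fold iterate. $k$-normal form and sandwiching: for $m>0$, $m\equiv_k A_ab+c$ means $m=A_ab+c$ and there exist $n\ge1$ and naturals $a_1..a_n$, $b_1..b_n$, $m_0..m_n$ (sandwiching values) with $m_0=0$; for $0\le i<n$: $A_{a_{i+1}}m_i\le m<A_{a_{i+1}+1}m_i$, $A_{a_{i+1}}b_{i+1}\le m<A_{a_{i+1}}(b_{i+1}+1)$, $m_{i+1}=A_{a_{i+1}}b_{i+1}$; $A_0m_n>m$; $a=a_n$, $b=b_n$. These data are uniquely determined by $m$. The penultimate sandwiching value of $m$ is $m_{ -1}:=m_{n-1}$. $m\equiv_k A_ab$ means $m\equiv_k A_ab+0$. -}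

module Defs where

open import Data.Nat using (ℕ; zero; suc; _+_; _*_; _∸_; _^_; _≤_; _<_)
open import Data.Product using (_×_)
open import Relation.Binary.PropositionalEquality using (_≡_)

iter : ℕ → (ℕ → ℕ) → ℕ → ℕ
iter zero    f x = x
iter (suc j) f x = f (iter j f x)

-- Shifted Ackermann: Ack' k a (suc b) = A_a(k,b),  Ack' k a 0 = A_a(k,-1) = 1.
Ack' : ℕ → ℕ → ℕ → ℕ
Ack' k a       zero    = 1
Ack' k zero    (suc b) = k ^ b
Ack' k (suc a) (suc b) = iter k (λ y → Ack' k a (suc y)) (Ack' k (suc a) b)

A : ℕ → ℕ → ℕ → ℕ
A k a b = Ack' k a (suc b)

-- k-normal form with its sandwiching data:  NF k m a b c  is  "m ≡_k A_a b + c".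
-- Sequences a_i, b_i (meaningful for 1 ≤ i ≤ n) and m_i (for 0 ≤ i ≤ n) are
-- given as functions ℕ → ℕ; values outside these ranges are irrelevant.
record NF (k m a b c : ℕ) : Set where
  field
    pos   : 0 < m
    value : m ≡ A k a b + c
    n     : ℕ
    n≥1   : 1 ≤ n
    as    : ℕ → ℕ
    bs    : ℕ → ℕ
    ms    : ℕ → ℕ
    m₀    : ms 0 ≡ 0
    steps : ∀ i → i < n →
              (A k (as (suc i)) (ms i) ≤ m × m < A k (suc (as (suc i))) (ms i))
            × (A k (as (suc i)) (bs (suc i)) ≤ m × m < A k (as (suc i)) (suc (bs (suc i))))
            × ms (suc i) ≡ A k (as (suc i)) (bs (suc i))
    final : m < A k 0 (ms n)
    a≡aₙ  : a ≡ as n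
    b≡bₙ  : b ≡ bs n

penultimate : ∀ {k m a b c} → NF k m a b c → ℕ
penultimate d = NF.ms d (NF.n d ∸ 1)

module Submission where

-- w gets the sandwiching data of m with only the last level replaced by (a, b). Once
-- m_i, a_{i+1}, b_{i+1} are fixed, level i only asks that the number lie in the interval
-- [m_{i+1}, A_{a_{i+1}}(b_{i+1}+1)). These intervals are nested (lower ends increase, upper
-- ends decrease), and w ≥ A_a b ≥ b ≥ m_{-1} while w < A_a(b+1), which does not exceed the
-- upper end of the last interval of m; so w lies in every earlier interval.

open import Defs
open import Data.Nat using (ℕ; zero; suc; _+_; _∸_; _≤_; _<_; _≥_; _≤′_; ≤′-refl; ≤′-step; z≤n; s≤s; z<s; _≟_)
open import Data.Nat.Properties
open import Data.Product using (Σ; ∃-syntax; _,_; _×_)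
open import Data.Sum using (_⊎_; inj₁; inj₂)
open import Function using (flip)
open import Relation.Nullary using (yes; no; contradiction)
open import Relation.Binary.PropositionalEquality

iter-inflationary : ∀ j f x → (∀ y → y < f y) → x ≤ iter j f x
iter-inflationary zero    f x f-infl = ≤-refl
iter-inflationary (suc j) f x f-infl = ≤-trans (iter-inflationary j f x f-infl) (<⇒≤ (f-infl _))

module StrictlyIncreasing (f : ℕ → ℕ) (f-step : ∀ y → f y < f (suc y)) where

  mono-≤ : ∀ {x y} → x ≤ y → f x ≤ f y
  mono-≤ x≤y = mono-≤′ (≤⇒≤′ x≤y)
    where
    mono-≤′ : ∀ {x y} → x ≤′ y → f x ≤ f y
    mono-≤′ ≤′-refl       = ≤-refl
    mono-≤′ (≤′-step x≤y) = ≤-trans (mono-≤′ x≤y) (<⇒≤ (f-step _))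

  cancel-< : ∀ {x y} → f x < f y → x < y
  cancel-< fx<fy = ≰⇒> (λ y≤x → <⇒≱ fx<fy (mono-≤ y≤x))

  inflationary : 0 < f 0 → ∀ y → y < f y
  inflationary f0>0 zero    = f0>0
  inflationary f0>0 (suc y) = ≤-<-trans (inflationary f0>0 y) (f-step y)

steps⇒chain : (_∼_ : ℕ → ℕ → Set) → (∀ {x} → x ∼ x) → (∀ {x y z} → x ∼ y → y ∼ z → x ∼ z) →
              (f : ℕ → ℕ) {n : ℕ} → (∀ i → suc i ≤ n → f i ∼ f (suc i)) →
              ∀ {i j} → i ≤ j → j ≤ n → f i ∼ f j
steps⇒chain _∼_ ∼-refl ∼-trans f {n} step i≤j = chain (≤⇒≤′ i≤j)
  where
  chain : ∀ {i j} → i ≤′ j → j ≤ n → f i ∼ f j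
  chain ≤′-refl               _     = ∼-refl
  chain (≤′-step {j} i≤j) 1+j≤n = ∼-trans (chain i≤j (≤-trans (n≤1+n j) 1+j≤n)) (step j 1+j≤n)

update : ℕ → ℕ → (ℕ → ℕ) → ℕ → ℕ
update i v f j with j ≟ i
... | yes _ = v
... | no  _ = f j

update-hit : ∀ i v f → update i v f i ≡ v
update-hit i v f with i ≟ i
... | yes _   = refl
... | no  i≢i = contradiction refl i≢i

update-miss : ∀ i v f {j} → j ≢ i → update i v f j ≡ f j
update-miss i v f {j} j≢i with j ≟ i
... | yes j≡i = contradiction j≡i j≢i
... | no  _   = refl

module Ackermann (k′ : ℕ) where

  k : ℕ
  k = 2 + k′

  A-step         : ∀ α y → A k α y < A k α (suc y)
  A-inflationary : ∀ α y → y < A k α y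

  A-step zero    y = ^-monoʳ-< k (s≤s (s≤s z≤n)) (n<1+n y)
  A-step (suc α) y =
    ≤-<-trans (iter-inflationary (suc k′) (A k α) _ (A-inflationary α)) (A-inflationary α _)

  A-inflationary zero    = StrictlyIncreasing.inflationary (A k zero) (A-step zero) z<s
  A-inflationary (suc α) = StrictlyIncreasing.inflationary (A k (suc α)) (A-step (suc α))
                             (<-≤-trans z<s (iter-inflationary k (A k α) 1 (A-inflationary α)))

  open module A-monoʳ (α : ℕ) = StrictlyIncreasing (A k α) (A-step α)
    using () renaming (mono-≤ to A-monoʳ-≤; cancel-< to A-cancelʳ-<) public

  A-suc-unfold : ∀ α y → A k (suc α) y ≡ A k α (iter (suc k′) (A k α) (Ack' k (suc α) y))
  A-suc-unfold α y = refl

  A-monoˡ-≤ : ∀ {α α′} y → α ≤ α′ → A k α y ≤ A k α′ y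
  A-monoˡ-≤ y α≤α′ = mono (≤⇒≤′ α≤α′)
    where
    y≤Ack' : ∀ α y → y ≤ Ack' k α y
    y≤Ack' α zero    = z≤n
    y≤Ack' α (suc y) = A-inflationary α y

    mono : ∀ {α α′} → α ≤′ α′ → A k α y ≤ A k α′ y
    mono ≤′-refl             = ≤-refl
    mono (≤′-step {α} α≤α′) = ≤-trans (mono α≤α′) (begin
      A k α y                                              ≤⟨ A-monoʳ-≤ α (≤-trans (y≤Ack' (suc α) y)
                                                                (iter-inflationary (suc k′) (A k α) _ (A-inflationary α))) ⟩
      A k α (iter (suc k′) (A k α) (Ack' k (suc α) y))   ≡⟨ sym (A-suc-unfold α y) ⟩
      A k (suc α) y                                        ∎)
      where open ≤-Reasoning

  A-image : ∀ {α′ α} → α′ ≤ α → ∀ y → ∃[ z ] A k α y ≡ A k α′ z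
  A-image {α′} α′≤α = image (≤⇒≤′ α′≤α)
    where
    image : ∀ {α} → α′ ≤′ α → ∀ y → ∃[ z ] A k α y ≡ A k α′ z
    image ≤′-refl              y = y , refl
    image (≤′-step {α} α′≤α) y =
      let z , eq = image α′≤α (iter (suc k′) (A k α) (Ack' k (suc α) y)) in z , trans (A-suc-unfold α y) eq

  A-suc-≤ : ∀ {α′ α β γ} → α′ ≤ α → A k α′ β < A k α γ → A k α′ (suc β) ≤ A k α γ
  A-suc-≤ {α′} {β = β} {γ} α′≤α lt with A-image α′≤α γ
  ... | _ , eq =
    subst (A k α′ (suc β) ≤_) (sym eq) (A-monoʳ-≤ α′ (A-cancelʳ-< α′ (subst (A k α′ β <_) eq lt)))

  _∈[_,_⟩ : ℕ → ℕ → ℕ → Set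
  x ∈[ l , u ⟩ = l ≤ x × x < u

  -- One level of the sandwiching data of x, as in the field NF.steps: μ = m_i, α = a_{i+1},
  -- β = b_{i+1}, ν = m_{i+1}.
  Step : ℕ → ℕ → ℕ → ℕ → ℕ → Set
  Step α μ β ν x = x ∈[ A k α μ , A k (suc α) μ ⟩ × x ∈[ A k α β , A k α (suc β) ⟩ × ν ≡ A k α β

  Step-cong : ∀ α′ {α μ μ′ β β′ ν ν′ x} → α′ ≡ α → μ′ ≡ μ → β′ ≡ β → ν′ ≡ ν →
              Step α μ β ν x → Step α′ μ′ β′ ν′ x
  Step-cong _ refl refl refl refl s = s

  Step⇒μ≤β : ∀ α {μ β ν x} → Step α μ β ν x → μ ≤ β
  Step⇒μ≤β α ((lo , _) , (_ , hi) , _) = m<1+n⇒m≤n (A-cancelʳ-< α (≤-<-trans lo hi))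

  Step⇒μ≤ν : ∀ α {μ β ν x} → Step α μ β ν x → μ ≤ ν
  Step⇒μ≤ν α {μ} {β} s@(_ , _ , eq) =
    ≤-trans (Step⇒μ≤β α s) (≤-trans (<⇒≤ (A-inflationary α β)) (≤-reflexive (sym eq)))

  Step⇒top≤ : ∀ α {μ β ν x} → Step α μ β ν x → A k α (suc β) ≤ A k (suc α) μ
  Step⇒top≤ α {μ} ((_ , hi) , (lo , _) , _) = A-suc-≤ {γ = μ} (n≤1+n α) (≤-<-trans lo hi)

  Step-intro : ∀ α {μ β ν x} → μ ≤ β → A k α (suc β) ≤ A k (suc α) μ → ν ≡ A k α β →
               x ∈[ A k α β , A k α (suc β) ⟩ → Step α μ β ν x
  Step-intro α μ≤β top≤ eq (lo , hi) =
    (≤-trans (A-monoʳ-≤ α μ≤β) lo , <-≤-trans hi top≤) , (lo , hi) , eq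

  Step-transfer : ∀ α {μ β ν x y} → Step α μ β ν x → ν ≤ y → y < A k α (suc β) → Step α μ β ν y
  Step-transfer α s@(_ , _ , eq) ν≤y y<top =
    Step-intro α (Step⇒μ≤β α s) (Step⇒top≤ α s) eq (subst (_≤ _) eq ν≤y , y<top)

  module NormalForm {m a b c} (d : NF k m a b c) where
    open NF d

    last : ℕ
    last = n ∸ 1

    n≡1+last : n ≡ suc last
    n≡1+last = trans (sym (m∸n+n≡m n≥1)) (+-comm last 1)

    last<n : last < n
    last<n = subst (last <_) (sym n≡1+last) (n<1+n last)

    a≡as-last : a ≡ as (suc last)
    a≡as-last = trans a≡aₙ (cong as n≡1+last)

    b≡bs-last : b ≡ bs (suc last)
    b≡bs-last = trans b≡bₙ (cong bs n≡1+last)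

    last-Step : Step a (ms last) b (ms (suc last)) m
    last-Step = Step-cong a a≡as-last refl b≡bs-last refl (steps last last<n)

    ceiling : ℕ → ℕ
    ceiling i = A k (as (suc i)) (suc (bs (suc i)))

    ceiling-last : A k a (suc b) ≡ ceiling last
    ceiling-last = cong₂ (λ α β → A k α (suc β)) a≡as-last b≡bs-last

    as-suc-≤ : ∀ i → suc i < n → as (suc (suc i)) ≤ as (suc i)
    as-suc-≤ i 1+i<n with steps i (<-trans (n<1+n i) 1+i<n) | steps (suc i) 1+i<n
    ... | _ , (_ , hi) , eq | (lo , _) , _ = ≮⇒≥ (λ α<α′ → <⇒≱ hi (top≤m α<α′))
      where
      α  = as (suc i)
      α′ = as (suc (suc i))
      β  = bs (suc i)

      top≤m : α < α′ → A k α (suc β) ≤ m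
      top≤m α<α′ = begin
        A k α (suc β)          ≤⟨ A-monoʳ-≤ α (A-inflationary α β) ⟩
        A k α (A k α β)        ≤⟨ A-monoˡ-≤ _ (<⇒≤ α<α′) ⟩
        A k α′ (A k α β)       ≡⟨ cong (A k α′) (sym eq) ⟩
        A k α′ (ms (suc i))    ≤⟨ lo ⟩
        m                      ∎
        where open ≤-Reasoning

    ceiling-suc-≤ : ∀ i → suc i < n → ceiling (suc i) ≤ ceiling i
    ceiling-suc-≤ i 1+i<n with steps i (<-trans (n<1+n i) 1+i<n) | steps (suc i) 1+i<n
    ... | _ , (_ , hi) , _ | _ , (lo , _) , _ = A-suc-≤ (as-suc-≤ i 1+i<n) (≤-<-trans lo hi)

    ms-mono : ∀ {i j} → i ≤ j → j ≤ n → ms i ≤ ms j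
    ms-mono = steps⇒chain _≤_ ≤-refl ≤-trans ms (λ i i<n → Step⇒μ≤ν (as (suc i)) (steps i i<n))

    ceiling-antitone : ∀ {i j} → i ≤ j → j ≤ last → ceiling j ≤ ceiling i
    ceiling-antitone = steps⇒chain _≥_ ≤-refl (flip ≤-trans) ceiling
      (λ i 1+i≤last → ceiling-suc-≤ i (subst (suc i <_) (sym n≡1+last) (s≤s 1+i≤last)))

  NF-replaceLast : ∀ {m a b₀ c₀ b c w} (d : NF k m a b₀ c₀) → penultimate d ≤ b → b ≤ b₀ →
                   A k a b + c ≡ w → w < A k a (suc b) → w < A k 0 (A k a b) → NF k w a b c
  NF-replaceLast {a = a} {b = b} {c = c} {w = w} d m₋₁≤b b≤b₀ w≡ w<top w<A₀ = record
    { pos   = <-≤-trans (≤-<-trans z≤n (A-inflationary a b)) Aab≤w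
    ; value = sym w≡
    ; n     = n
    ; n≥1   = n≥1
    ; as    = as
    ; bs    = bs′
    ; ms    = ms′
    ; m₀    = trans (ms′-miss (λ ())) m₀
    ; steps = steps′
    ; final = subst (λ t → w < A k 0 t) (sym (trans (cong ms′ n≡1+last) ms′-hit)) w<A₀
    ; a≡aₙ  = a≡aₙ
    ; b≡bₙ  = sym (trans (cong bs′ n≡1+last) bs′-hit)
    }
    where
    open NF d
    open NormalForm d

    bs′ ms′ : ℕ → ℕ
    bs′ = update (suc last) b bs
    ms′ = update (suc last) (A k a b) ms

    bs′-hit : bs′ (suc last) ≡ b
    bs′-hit = update-hit (suc last) b bs

    ms′-hit : ms′ (suc last) ≡ A k a b
    ms′-hit = update-hit (suc last) (A k a b) ms

    bs′-miss : ∀ {j} → j ≢ suc last → bs′ j ≡ bs j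
    bs′-miss = update-miss (suc last) b bs

    ms′-miss : ∀ {j} → j ≢ suc last → ms′ j ≡ ms j
    ms′-miss = update-miss (suc last) (A k a b) ms

    Aab≤w : A k a b ≤ w
    Aab≤w = subst (A k a b ≤_) w≡ (m≤m+n _ c)

    w<ceiling-last : w < ceiling last
    w<ceiling-last = <-≤-trans w<top (≤-trans (A-monoʳ-≤ a (s≤s b≤b₀)) (≤-reflexive ceiling-last))

    inherited : ∀ i → i < last → Step (as (suc i)) (ms′ i) (bs′ (suc i)) (ms′ (suc i)) w
    inherited i i<last =
      Step-cong (as (suc i)) refl (ms′-miss (<⇒≢ (m<n⇒m<1+n i<last))) (bs′-miss (<⇒≢ (s≤s i<last)))
                (ms′-miss (<⇒≢ (s≤s i<last)))
        (Step-transfer (as (suc i)) (steps i (<-trans i<last last<n)) ms₁₊ᵢ≤w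
          (<-≤-trans w<ceiling-last (ceiling-antitone (<⇒≤ i<last) ≤-refl)))
      where
      ms₁₊ᵢ≤w : ms (suc i) ≤ w
      ms₁₊ᵢ≤w = ≤-trans (ms-mono i<last (<⇒≤ last<n))
                  (≤-trans m₋₁≤b (≤-trans (<⇒≤ (A-inflationary a b)) Aab≤w))

    replaced : Step (as (suc last)) (ms′ last) (bs′ (suc last)) (ms′ (suc last)) w
    replaced =
      Step-cong (as (suc last)) (sym a≡as-last) (ms′-miss (<⇒≢ (n<1+n last))) bs′-hit ms′-hit
        (Step-intro a m₋₁≤b (≤-trans (A-monoʳ-≤ a (s≤s b≤b₀)) (Step⇒top≤ a last-Step)) refl
          (Aab≤w , w<top))

    steps′ : ∀ i → i < n → Step (as (suc i)) (ms′ i) (bs′ (suc i)) (ms′ (suc i)) w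
    steps′ i i<n with m≤n⇒m<n∨m≡n (m<1+n⇒m≤n (subst (i <_) n≡1+last i<n))
    ... | inj₁ i<last = inherited i i<last
    ... | inj₂ refl   = replaced

lemma3p8 : (k : ℕ) → 2 ≤ k → (a b c m w : ℕ) →
    A k a b + c ≡ w → w < A k a (suc b) → w < A k 0 (A k a b) →
    ((Σ (NF k m a (suc b) 0) (λ d → A k a (penultimate d) < A k a (suc b)))
      ⊎ (Σ ℕ (λ c' → NF k m a b c'))) →
    NF k w a b c
lemma3p8 (suc (suc k′)) (s≤s (s≤s z≤n)) a b c m w w≡ w<top w<A₀ (inj₁ (d , A-m₋₁<top)) =
  NF-replaceLast d (m<1+n⇒m≤n (A-cancelʳ-< a A-m₋₁<top)) (n≤1+n b) w≡ w<top w<A₀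
  where open Ackermann k′
lemma3p8 (suc (suc k′)) (s≤s (s≤s z≤n)) a b c m w w≡ w<top w<A₀ (inj₂ (_ , d)) =
  NF-replaceLast d (Step⇒μ≤β a (NormalForm.last-Step d)) ≤-refl w≡ w<top w<A₀
  where open Ackermann k′
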